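{- Let $k$ be an odd positive integer and, for odd positive $m$, let $F_m:\mathbb{N}\to\mathbb{N}$ be given by $F_m(n)=\frac{3n+m}{2}$ if $n$ is odd and $F_m(n)=\frac{n}{2}$ if $n$ is even. Let $C$ be a cycle of $F_k$ with minimal element $T_0$ and orb sequence $(u_1,d_1,\dots,u_s,d_s)$ read from $T_0$. Then for every odd positive integer $r$, the set $rC=\{rx:x\in C\}$ is a cycle of $F_{rk}$, its minimal element is $rT_0$, and its orb sequence read from $rT_0$ is the same $(u_1,d_1,\dots,u_s,d_s)$.
   Context: A cycle of $F_m$ is a set $\{x,F_m(x),\dots,F_m^{p-1}(x)\}$ with $x\in\mathbb{N}$, $p\ge1$, $F_m^p(x)=x$. The orb sequence read from an odd element $T_0$ of a cycle is the list of lengths of alternating maximal blocks of consecutive odd iterates ($u_i$) and consecutive even iterates ($d_i$) encountered when iterating from $T_0$ once around the cycle. -}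

module Defs where

open import Data.Nat using (ℕ; zero; suc; _+_; _*_; _≤_; _<_; _%_; _/_; _≡ᵇ_)
open import Data.Bool using (Bool; true; false; if_then_else_; not)
open import Data.List using (List; []; _∷_; _++_; replicate; map; upTo; concatMap)
open import Data.Product using (_×_; _,_; Σ; ∃; ∃-syntax)
open import Relation.Binary.PropositionalEquality using (_≡_; _≢_)
open import Relation.Nullary using (¬_)

isOdd : ℕ → Bool
isOdd n = not (n % 2 ≡ᵇ 0)

Odd : ℕ → Set
Odd n = n % 2 ≡ 1

F : ℕ → ℕ → ℕ
F m n = if isOdd n then (3 * n + m) / 2 else n / 2

iter : ℕ → ℕ → ℕ → ℕ
iter m zero    x = x
iter m (suc i) x = F m (iter m i x)

Subset : Set₁
Subset = ℕ → Set

scale : ℕ → Subset → Subset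
scale r C y = ∃[ x ] (C x × y ≡ r * x)

IsCycle : ℕ → Subset → Set
IsCycle m C = ∃[ x ] ∃[ p ] (1 ≤ x × 1 ≤ p × iter m p x ≡ x ×
  (∀ y → (C y → ∃[ i ] (i < p × y ≡ iter m i x)) × (∃[ i ] (i < p × y ≡ iter m i x) → C y)))

IsMinElem : Subset → ℕ → Set
IsMinElem C t = C t × (∀ y → C y → t ≤ y)

MinPeriod : ℕ → ℕ → ℕ → Set
MinPeriod m x p = 1 ≤ p × iter m p x ≡ x × (∀ q → 1 ≤ q → q < p → iter m q x ≢ x)

parityWord : ℕ → ℕ → ℕ → List Bool
parityWord m x p = map (λ i → isOdd (iter m i x)) (upTo p)

blocksWord : List (ℕ × ℕ) → List Bool
blocksWord = concatMap (λ { (u , d) → replicate u true ++ replicate d false })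

AllPos : List (ℕ × ℕ) → Set
AllPos [] = Data.Unit.⊤ where import Data.Unit
AllPos ((u , d) ∷ s) = 1 ≤ u × 1 ≤ d × AllPos s

-- s is the orb sequence of F_m read from the odd element x: the maximal
-- alternating blocks of odd / even iterates during one trip around the cycle
OrbSeq : ℕ → ℕ → List (ℕ × ℕ) → Set
OrbSeq m x s = Odd x × AllPos s × ∃[ p ] (MinPeriod m x p × parityWord m x p ≡ blocksWord s)

module Submission where

-- The whole theorem rests on one identity: for odd k and odd r,
--   F_{rk}(r·x) = r·F_k(x),
-- i.e. multiplication by r conjugates F_k to F_{rk}.  It holds because an odd
-- r preserves parity (so both sides take the same branch of F) and r can be
-- pulled out of the halving, the halved quantity x or 3x+k being even.
-- Iterating gives F_{rk}^i(r·x) = r·F_k^i(x).  From such a conjugacy by a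
-- nonzero, parity-preserving factor the three conclusions follow formally:
--   * the image rC of a cycle C is a cycle (same base point times r, same period);
--   * the minimal element is scaled, since x ↦ r·x is monotone;
--   * the orb sequence is unchanged, since the minimal period is preserved
--     (r·x is cancellable) and the parity word of the scaled orbit is the same.

open import Defs
open import Data.Nat using (ℕ; zero; suc; _*_; _+_; _%_; _/_; _≤_; _<_; s≤s; _≡ᵇ_; NonZero)
open import Data.Nat.Properties using (*-identityˡ; *-monoʳ-≤; *-cancelˡ-≡; m≤n⇒m≤o*n)
open import Data.Nat.DivMod using (m%n<n; %-distribˡ-*; %-distribˡ-+; m%n%n≡m%n; *-/-assoc)
open import Data.Nat.Divisibility using (m%n≡0⇒n∣m)
open import Data.Bool using (not)
open import Data.List using (List; []; _∷_; upTo)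
open import Data.List.Properties using (map-cong)
open import Data.Product using (_×_; _,_; proj₁; proj₂; ∃-syntax)
open import Data.Sum using (_⊎_; inj₁; inj₂)
open import Relation.Binary.PropositionalEquality
open import Data.Nat.Tactic.RingSolver using (solve)

parity : ∀ n → n % 2 ≡ 0 ⊎ n % 2 ≡ 1
parity n with n % 2 | m%n<n n 2
... | 0           | _               = inj₁ refl
... | 1           | _               = inj₂ refl
... | suc (suc _) | s≤s (s≤s ())

odd*-parity : ∀ r n → Odd r → (r * n) % 2 ≡ n % 2
odd*-parity r n odd-r = begin
  (r * n) % 2               ≡⟨ %-distribˡ-* r n 2 ⟩
  ((r % 2) * (n % 2)) % 2   ≡⟨ cong (λ t → (t * (n % 2)) % 2) odd-r ⟩
  (1 * (n % 2)) % 2         ≡⟨ cong (_% 2) (*-identityˡ (n % 2)) ⟩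
  (n % 2) % 2               ≡⟨ m%n%n≡m%n n 2 ⟩
  n % 2                     ∎
  where open ≡-Reasoning

isOdd-cong : ∀ a b → a % 2 ≡ b % 2 → isOdd a ≡ isOdd b
isOdd-cong a b eq = cong (λ t → not (t ≡ᵇ 0)) eq

odd+odd-even : ∀ a b → Odd a → Odd b → (a + b) % 2 ≡ 0
odd+odd-even a b odd-a odd-b = begin
  (a + b) % 2             ≡⟨ %-distribˡ-+ a b 2 ⟩
  (a % 2 + b % 2) % 2     ≡⟨ cong₂ (λ u v → (u + v) % 2) odd-a odd-b ⟩
  0                       ∎
  where open ≡-Reasoning

odd⇒nonZero : ∀ r → Odd r → NonZero r
odd⇒nonZero (suc _) _ = _

F-odd : ∀ m x → Odd x → F m x ≡ (3 * x + m) / 2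
F-odd m x odd-x rewrite isOdd-cong x 1 odd-x = refl

F-even : ∀ m x → x % 2 ≡ 0 → F m x ≡ x / 2
F-even m x even-x rewrite isOdd-cong x 0 even-x = refl

-- The key identity F_{rk}(r·x) = r·F_k(x) for odd k, r; in the odd case the
-- oddness of k makes 3x+k even, so r can be pulled out of the halving.
F-scale : ∀ k r x → Odd k → Odd r → F (r * k) (r * x) ≡ r * F k x
F-scale k r x odd-k odd-r with parity x
... | inj₁ even-x = begin
    F (r * k) (r * x)  ≡⟨ F-even (r * k) (r * x) (trans (odd*-parity r x odd-r) even-x) ⟩
    (r * x) / 2        ≡⟨ *-/-assoc r (m%n≡0⇒n∣m x 2 even-x) ⟩
    r * (x / 2)        ≡⟨ cong (r *_) (sym (F-even k x even-x)) ⟩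
    r * F k x          ∎
  where open ≡-Reasoning
... | inj₂ odd-x = begin
    F (r * k) (r * x)           ≡⟨ F-odd (r * k) (r * x) (trans (odd*-parity r x odd-r) odd-x) ⟩
    (3 * (r * x) + r * k) / 2   ≡⟨ cong (_/ 2) factor-r ⟩
    r * (3 * x + k) / 2         ≡⟨ *-/-assoc r (m%n≡0⇒n∣m (3 * x + k) 2 even-3x+k) ⟩
    r * ((3 * x + k) / 2)       ≡⟨ cong (r *_) (sym (F-odd k x odd-x)) ⟩
    r * F k x                   ∎
  where
  open ≡-Reasoning
  factor-r : 3 * (r * x) + r * k ≡ r * (3 * x + k)
  factor-r = solve (r ∷ x ∷ k ∷ [])
  even-3x+k : (3 * x + k) % 2 ≡ 0
  even-3x+k = odd+odd-even (3 * x) k (trans (odd*-parity 3 x refl) odd-x) odd-k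

Conjugates : ℕ → ℕ → ℕ → Set
Conjugates m m' r = ∀ i y → iter m' i (r * y) ≡ r * iter m i y

iter-scale : ∀ k r → Odd k → Odd r → Conjugates k (r * k) r
iter-scale k r odd-k odd-r zero    y = refl
iter-scale k r odd-k odd-r (suc i) y =
  trans (cong (F (r * k)) (iter-scale k r odd-k odd-r i y)) (F-scale k r (iter k i y) odd-k odd-r)

OnOrbit : ℕ → ℕ → ℕ → ℕ → Set
OnOrbit m x p y = ∃[ i ] (i < p × y ≡ iter m i x)

scale-cycle : ∀ m m' r .{{_ : NonZero r}} → Conjugates m m' r →
              ∀ C → IsCycle m C → IsCycle m' (scale r C)
scale-cycle m m' r conj C (x , p , x≥1 , p≥1 , closes , members) =
  r * x , p , m≤n⇒m≤o*n r x≥1 , p≥1 , trans (conj p x) (cong (r *_) closes) ,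
  λ y → image⇒orbit y , orbit⇒image y
  where
  image⇒orbit : ∀ y → scale r C y → OnOrbit m' (r * x) p y
  image⇒orbit y (z , Cz , y≡rz) with proj₁ (members z) Cz
  ... | i , i<p , z≡Fⁱx = i , i<p , trans y≡rz (trans (cong (r *_) z≡Fⁱx) (sym (conj i x)))
  orbit⇒image : ∀ y → OnOrbit m' (r * x) p y → scale r C y
  orbit⇒image y (i , i<p , y≡Fⁱrx) =
    iter m i x , proj₂ (members _) (i , i<p , refl) , trans y≡Fⁱrx (conj i x)

-- Scaling by any factor is monotone, so it maps the minimum of C to that of rC.
scale-minElem : ∀ r C t → IsMinElem C t → IsMinElem (scale r C) (r * t)
scale-minElem r C t (Ct , t-least) =
  (t , Ct , refl) , λ { y (z , Cz , refl) → *-monoʳ-≤ r (t-least z Cz) }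

-- A conjugacy by a nonzero factor preserves minimal periods (r· is injective).
scale-minPeriod : ∀ m m' r .{{_ : NonZero r}} → Conjugates m m' r →
                  ∀ x p → MinPeriod m x p → MinPeriod m' (r * x) p
scale-minPeriod m m' r conj x p (p≥1 , closes , minimal) =
  p≥1 , trans (conj p x) (cong (r *_) closes) ,
  λ q q≥1 q<p returns → minimal q q≥1 q<p (*-cancelˡ-≡ _ _ r (trans (sym (conj q x)) returns))

scale-parityWord : ∀ m m' r → Odd r → Conjugates m m' r →
                   ∀ x p → parityWord m' (r * x) p ≡ parityWord m x p
scale-parityWord m m' r odd-r conj x p = map-cong same-parity (upTo p)
  where
  same-parity : ∀ i → isOdd (iter m' i (r * x)) ≡ isOdd (iter m i x)
  same-parity i = isOdd-cong (iter m' i (r * x)) (iter m i x)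
    (trans (cong (_% 2) (conj i x)) (odd*-parity r (iter m i x) odd-r))

scale-orbSeq : ∀ m m' r → Odd r → Conjugates m m' r →
               ∀ x s → OrbSeq m x s → OrbSeq m' (r * x) s
scale-orbSeq m m' r odd-r conj x s (odd-x , blocks-pos , p , min-p , word) =
  trans (odd*-parity r x odd-r) odd-x , blocks-pos , p ,
  scale-minPeriod m m' r {{odd⇒nonZero r odd-r}} conj x p min-p ,
  trans (scale-parityWord m m' r odd-r conj x p) word

theorem8 : (k : ℕ) → Odd k → (C : Subset) → IsCycle k C → (T₀ : ℕ) → IsMinElem C T₀ →
    (s : List (ℕ × ℕ)) → OrbSeq k T₀ s → (r : ℕ) → Odd r →
    IsCycle (r * k) (scale r C) × IsMinElem (scale r C) (r * T₀) × OrbSeq (r * k) (r * T₀) s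
theorem8 k odd-k C cycle T₀ min-T₀ s orb r odd-r =
  scale-cycle k (r * k) r {{odd⇒nonZero r odd-r}} conj C cycle ,
  scale-minElem r C T₀ min-T₀ ,
  scale-orbSeq k (r * k) r odd-r conj T₀ s orb
  where
  conj : Conjugates k (r * k) r
  conj = iter-scale k r odd-k odd-r
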